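{- Let $a,b,c,p_1,q_1,r_1,p_2,q_2,r_2$ be real numbers with $c\neq 0$. Let $(P_n)_{n\in\mathbb{Z}}=\mathcal{P}(x)(p_1,q_1,r_1;a,b,c)$, $(Q_n)_{n\in\mathbb{Z}}=\mathcal{P}(x)(p_2,q_2,r_2;a,b,c)$ and $(U_n)_{n\in\mathbb{Z}}=\mathcal{P}(x)(0,0,1;a,b,c)$. Then for all integers $s,i,j$, \[ P_{s+i} Q_{s+j} - P_{s} Q_{s+i+j} = (-c)^s (P_1 Q_j - P_0 Q_{j+1})\, U_i . \]
   Context: For real numbers $p,q,r,a,b,c$ with $c\neq 0$, $\mathcal{P}(x)(p,q,r;a,b,c)=(P_n)_{n\in\mathbb{Z}}$ denotes the sequence of polynomials in the variable $x$ defined by $P_0=p$, $P_1=qx+r$, $P_{n+2}=(ax+b)P_{n+1}+cP_n$ for $n\ge 0$, and for $n<0$ by $P_n=-\frac{ax+b}{c}P_{n+1}+\frac{1}{c}P_{n+2}$. In particular $(U_n)=\mathcal{P}(x)(0,0,1;a,b,c)$ satisfies $U_0=0$, $U_1=1$ and the same recurrence. -}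

module Defs where

open import Algebra.Bundles using (CommutativeRing)
open import Data.Nat using (ℕ; zero; suc)
open import Data.Integer using (ℤ; +_; -[1+_])
open import Data.Product using (_×_; _,_; proj₁)

-- The sequences P(x)(p,q,r;a,b,c), with x and all parameters living in a
-- commutative ring R in which c has a (chosen) inverse c⁻ (c * c⁻ ≈ 1#).
-- Taking R = ℝ[x] and x = the indeterminate recovers the polynomial sequences.
module Seq {ℓ₁ ℓ₂} (R : CommutativeRing ℓ₁ ℓ₂) where
  open CommutativeRing R

  pow : Carrier → ℕ → Carrier
  pow u zero    = 1#
  pow u (suc n) = u * pow u n

  zpow : (u uinv : Carrier) → ℤ → Carrier
  zpow u uinv (+ n)     = pow u n
  zpow u uinv -[1+ n ]  = pow uinv (suc n)

  fwd : (a b c x : Carrier) → Carrier × Carrier → Carrier × Carrier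
  fwd a b c x (u , v) = v , ((a * x + b) * v + c * u)

  -- backward step on pairs (P_{n+1} , P_{n+2}) ↦ (P_n , P_{n+1}),
  -- P_n = -((ax+b)/c) P_{n+1} + (1/c) P_{n+2}
  bwd : (a b c⁻ x : Carrier) → Carrier × Carrier → Carrier × Carrier
  bwd a b c⁻ x (u , v) = (- ((a * x + b) * c⁻) * u + c⁻ * v) , u

  iter : ∀ {A : Set ℓ₁} → (A → A) → ℕ → A → A
  iter f zero    z = z
  iter f (suc n) z = f (iter f n z)

  Pseq : (p q r a b c c⁻ x : Carrier) → ℤ → Carrier
  Pseq p q r a b c c⁻ x (+ n)    = proj₁ (iter (fwd a b c x) n (p , (q * x + r)))
  Pseq p q r a b c c⁻ x -[1+ n ] = proj₁ (iter (bwd a b c⁻ x) (suc n) (p , (q * x + r)))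

{-# OPTIONS --safe #-}
-- When c is a unit, a solution of f (n + 2) = k f (n + 1) + c f n on ℤ is determined by two
-- consecutive values, so comparing both sides as solutions in i gives the addition formula
-- f (s + i) = U i f (s + 1) + c U (i - 1) f s.  Substituting it for P at s and for Q at s + j
-- leaves U i times the Casoratian P (s + 1) Q (s + j) - P s Q (s + j + 1), which the recurrence
-- multiplies by -c at each step in s.
module Submission where

open import Defs
open import Algebra.Bundles using (CommutativeRing)
import Algebra.Properties.Group as GroupProperties
import Algebra.Properties.Quasigroup as QuasigroupProperties
open import Algebra.Solver.Ring.AlmostCommutativeRing
  using (fromCommutativeRing; _-Raw-AlmostCommutative⟶_)
open import Data.Integer as ℤ using (ℤ; +_; -[1+_]; 0ℤ; 1ℤ)
import Data.Integer.Properties as ℤP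
open import Algebra.Properties.CommutativeSemigroup ℤP.+-commutativeSemigroup
  using (x∙yz≈y∙xz; xy∙z≈xz∙y)
open import Data.Maybe using (Maybe; just; nothing)
open import Data.Nat using (ℕ; zero; suc)
open import Data.Product using (_×_; _,_; proj₁; proj₂)
open import Relation.Nullary using (yes; no)
import Relation.Binary.PropositionalEquality as ≡

ℤ-induction : ∀ {ℓ} (P : ℤ → Set ℓ) → P 0ℤ →
              (∀ i → P i → P (ℤ.suc i)) → (∀ i → P (ℤ.suc i) → P i) →
              ∀ i → P i
ℤ-induction P P0 up down (+ n) = nonNegative n
  where
  nonNegative : ∀ n → P (+ n)
  nonNegative zero    = P0
  nonNegative (suc n) = up (+ n) (nonNegative n)
ℤ-induction P P0 up down -[1+ n ] = negative n
  where
  negative : ∀ n → P -[1+ n ]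
  negative zero    = down -[1+ 0 ] P0
  negative (suc n) = down -[1+ suc n ] (negative n)

-- The ring solver cancels terms such as x - x only for coefficients with decidable equality;
-- these come from the canonical map ℤ → R.
module IntegerCoefficientSolver {ℓ₁ ℓ₂} (R : CommutativeRing ℓ₁ ℓ₂) where
  open CommutativeRing R
  open import Algebra.Definitions.RawMonoid +-rawMonoid using () renaming (_×_ to _×ₙ_)
  open import Algebra.Properties.Ring ring using (-0#≈0#; -‿involutive; -‿+-comm)
  open QuasigroupProperties (GroupProperties.quasigroup +-group) using (cancelˡ)
  open import Relation.Binary.Reasoning.Setoid setoid

  fromℤ : ℤ → Carrier
  fromℤ (+ n)    = n ×ₙ 1#
  fromℤ -[1+ n ] = - (suc n ×ₙ 1#)

  private
    -y≈1-[1+y] : ∀ y → - y ≈ 1# + - (1# + y)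
    -y≈1-[1+y] y = begin
      - y               ≈⟨ +-identityˡ (- y) ⟨
      0# + - y          ≈⟨ +-congʳ (-‿inverseʳ 1#) ⟨
      (1# + - 1#) + - y ≈⟨ +-assoc 1# (- 1#) (- y) ⟩
      1# + (- 1# + - y) ≈⟨ +-congˡ (-‿+-comm 1# y) ⟩
      1# + - (1# + y)   ∎

  fromℤ-suc : ∀ i → fromℤ (ℤ.suc i) ≈ 1# + fromℤ i
  fromℤ-suc (+ n)          = refl
  fromℤ-suc -[1+ zero ]    = trans (sym -0#≈0#) (-y≈1-[1+y] 0#)
  fromℤ-suc -[1+ suc n ]   = -y≈1-[1+y] (suc n ×ₙ 1#)

  increments-unique : ∀ (f g : ℤ → Carrier) t → f 0ℤ ≈ g 0ℤ →
                      (∀ i → f (ℤ.suc i) ≈ t + f i) → (∀ i → g (ℤ.suc i) ≈ t + g i) →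
                      ∀ i → f i ≈ g i
  increments-unique f g t f0≈g0 f-suc g-suc = ℤ-induction (λ i → f i ≈ g i) f0≈g0
    (λ i fi≈gi → trans (f-suc i) (trans (+-congˡ fi≈gi) (sym (g-suc i))))
    (λ i fsi≈gsi → cancelˡ t (f i) (g i) (trans (sym (f-suc i)) (trans fsi≈gsi (g-suc i))))

  fromℤ-+ : ∀ i j → fromℤ (i ℤ.+ j) ≈ fromℤ i + fromℤ j
  fromℤ-+ i j = increments-unique (λ i → fromℤ (i ℤ.+ j)) (λ i → fromℤ i + fromℤ j) 1#
    (trans (reflexive (≡.cong fromℤ (ℤP.+-identityˡ j))) (sym (+-identityˡ (fromℤ j))))
    (λ i → trans (reflexive (≡.cong fromℤ (ℤP.+-assoc 1ℤ i j))) (fromℤ-suc (i ℤ.+ j)))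
    (λ i → trans (+-congʳ (fromℤ-suc i)) (+-assoc 1# (fromℤ i) (fromℤ j)))
    i

  fromℤ-* : ∀ i j → fromℤ (i ℤ.* j) ≈ fromℤ i * fromℤ j
  fromℤ-* i j = increments-unique (λ i → fromℤ (i ℤ.* j)) (λ i → fromℤ i * fromℤ j) (fromℤ j)
    (sym (zeroˡ (fromℤ j)))
    (λ i → trans (reflexive (≡.cong fromℤ (ℤP.suc-* i j))) (fromℤ-+ j (i ℤ.* j)))
    (λ i → begin
      fromℤ (ℤ.suc i) * fromℤ j        ≈⟨ *-congʳ (fromℤ-suc i) ⟩
      (1# + fromℤ i) * fromℤ j         ≈⟨ distribʳ (fromℤ j) 1# (fromℤ i) ⟩
      1# * fromℤ j + fromℤ i * fromℤ j ≈⟨ +-congʳ (*-identityˡ (fromℤ j)) ⟩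
      fromℤ j + fromℤ i * fromℤ j      ∎)
    i

  fromℤ-neg : ∀ i → fromℤ (ℤ.- i) ≈ - fromℤ i
  fromℤ-neg (+ zero)  = sym -0#≈0#
  fromℤ-neg (+ suc n) = refl
  fromℤ-neg -[1+ n ]  = sym (-‿involutive (suc n ×ₙ 1#))

  fromℤ-homomorphism : ℤ.+-*-rawRing -Raw-AlmostCommutative⟶ fromCommutativeRing R
  fromℤ-homomorphism = record
    { ⟦_⟧    = fromℤ
    ; +-homo = fromℤ-+
    ; *-homo = fromℤ-*
    ; -‿homo = fromℤ-neg
    ; 0-homo = refl
    ; 1-homo = +-identityʳ 1#
    }

  private
    _≟ᶜ_ : ∀ i j → Maybe (fromℤ i ≈ fromℤ j)
    i ≟ᶜ j with i ℤ.≟ j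
    ... | yes ≡.refl = just refl
    ... | no _       = nothing

  open import Algebra.Solver.Ring ℤ.+-*-rawRing (fromCommutativeRing R) fromℤ-homomorphism _≟ᶜ_
    public

module _ {ℓ₁ ℓ₂} (R : CommutativeRing ℓ₁ ℓ₂) where
  open CommutativeRing R
  open Seq R
  open IntegerCoefficientSolver R using (solve; _:=_; _:+_; _:*_; _:-_; :-_)
  open QuasigroupProperties (GroupProperties.quasigroup +-group) using (cancelˡ)
  open import Relation.Binary.Reasoning.Setoid setoid

  module _ {u u⁻ : Carrier} (uu⁻≈1 : u * u⁻ ≈ 1#) where

    u*[u⁻*y]≈y : ∀ y → u * (u⁻ * y) ≈ y
    u*[u⁻*y]≈y y = begin
      u * (u⁻ * y) ≈⟨ *-assoc u u⁻ y ⟨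
      u * u⁻ * y   ≈⟨ *-congʳ uu⁻≈1 ⟩
      1# * y       ≈⟨ *-identityˡ y ⟩
      y            ∎

    *-cancelˡ-unit : ∀ {y z} → u * y ≈ u * z → y ≈ z
    *-cancelˡ-unit {y} {z} uy≈uz = begin
      y            ≈⟨ u⁻*[u*y]≈y y ⟨
      u⁻ * (u * y) ≈⟨ *-congˡ uy≈uz ⟩
      u⁻ * (u * z) ≈⟨ u⁻*[u*y]≈y z ⟩
      z            ∎
      where
      u⁻*[u*y]≈y : ∀ y → u⁻ * (u * y) ≈ y
      u⁻*[u*y]≈y y = trans (solve 3 (λ u v y → v :* (u :* y) := u :* (v :* y)) refl u u⁻ y)
                           (u*[u⁻*y]≈y y)

    zpow-suc : ∀ i → zpow u u⁻ (ℤ.suc i) ≈ u * zpow u u⁻ i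
    zpow-suc (+ n)        = refl
    zpow-suc -[1+ zero ]  = sym (u*[u⁻*y]≈y 1#)
    zpow-suc -[1+ suc n ] = sym (u*[u⁻*y]≈y (pow u⁻ (suc n)))

    geometric : (h : ℤ → Carrier) → (∀ i → h (ℤ.suc i) ≈ u * h i) →
                ∀ i → h i ≈ zpow u u⁻ i * h 0ℤ
    geometric h h-suc = ℤ-induction (λ i → h i ≈ zpow u u⁻ i * h 0ℤ)
      (sym (*-identityˡ (h 0ℤ)))
      (λ i hi≈ → trans (h-suc i) (trans (*-congˡ hi≈) (u*zpow i)))
      (λ i hsi≈ → *-cancelˡ-unit (trans (sym (h-suc i)) (trans hsi≈ (sym (u*zpow i)))))
      where
      u*zpow : ∀ i → u * (zpow u u⁻ i * h 0ℤ) ≈ zpow u u⁻ (ℤ.suc i) * h 0ℤ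
      u*zpow i = trans (sym (*-assoc u _ (h 0ℤ))) (*-congʳ (sym (zpow-suc i)))

  module _ (k c : Carrier) where

    IsSolution : (ℤ → Carrier) → Set ℓ₂
    IsSolution f = ∀ i → f (ℤ.suc (ℤ.suc i)) ≈ k * f (ℤ.suc i) + c * f i

    solution-shift : ∀ {f} → IsSolution f → ∀ m → IsSolution (λ i → f (m ℤ.+ i))
    solution-shift {f} f-sol m i = begin
      f (m ℤ.+ ℤ.suc (ℤ.suc i))
        ≡⟨ ≡.cong f (≡.trans (+-suc m (ℤ.suc i)) (≡.cong ℤ.suc (+-suc m i))) ⟩
      f (ℤ.suc (ℤ.suc (m ℤ.+ i)))
        ≈⟨ f-sol (m ℤ.+ i) ⟩
      k * f (ℤ.suc (m ℤ.+ i)) + c * f (m ℤ.+ i)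
        ≡⟨ ≡.cong (λ t → k * f t + c * f (m ℤ.+ i)) (+-suc m i) ⟨
      k * f (m ℤ.+ ℤ.suc i) + c * f (m ℤ.+ i) ∎
      where
      +-suc : ∀ m i → m ℤ.+ ℤ.suc i ≡.≡ ℤ.suc (m ℤ.+ i)
      +-suc m i = x∙yz≈y∙xz m 1ℤ i

    solution-lincomb : ∀ {f g} → IsSolution f → IsSolution g →
                       ∀ α β → IsSolution (λ i → f i * α + g i * β)
    solution-lincomb {f} {g} f-sol g-sol α β i = begin
      f (ℤ.suc (ℤ.suc i)) * α + g (ℤ.suc (ℤ.suc i)) * β
        ≈⟨ +-cong (*-congʳ (f-sol i)) (*-congʳ (g-sol i)) ⟩
      (k * f (ℤ.suc i) + c * f i) * α + (k * g (ℤ.suc i) + c * g i) * β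
        ≈⟨ solve 8 (λ k c f₁ f₀ g₁ g₀ α β →
                      (k :* f₁ :+ c :* f₀) :* α :+ (k :* g₁ :+ c :* g₀) :* β
                   := k :* (f₁ :* α :+ g₁ :* β) :+ c :* (f₀ :* α :+ g₀ :* β))
                 refl k c (f (ℤ.suc i)) (f i) (g (ℤ.suc i)) (g i) α β ⟩
      k * (f (ℤ.suc i) * α + g (ℤ.suc i) * β) + c * (f i * α + g i * β) ∎

    casoratian : (f g : ℤ → Carrier) → ℤ → Carrier
    casoratian f g i = f (ℤ.suc i) * g i - f i * g (ℤ.suc i)

    casoratian-suc : ∀ {f g} → IsSolution f → IsSolution g →
                     ∀ i → casoratian f g (ℤ.suc i) ≈ (- c) * casoratian f g i
    casoratian-suc {f} {g} f-sol g-sol i = begin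
      f (ℤ.suc (ℤ.suc i)) * g (ℤ.suc i) - f (ℤ.suc i) * g (ℤ.suc (ℤ.suc i))
        ≈⟨ +-cong (*-congʳ (f-sol i)) (-‿cong (*-congˡ (g-sol i))) ⟩
      (k * f (ℤ.suc i) + c * f i) * g (ℤ.suc i) - f (ℤ.suc i) * (k * g (ℤ.suc i) + c * g i)
        ≈⟨ solve 6 (λ k c f₁ f₀ g₁ g₀ →
                      (k :* f₁ :+ c :* f₀) :* g₁ :- f₁ :* (k :* g₁ :+ c :* g₀)
                   := (:- c) :* (f₁ :* g₀ :- f₀ :* g₁))
                 refl k c (f (ℤ.suc i)) (f i) (g (ℤ.suc i)) (g i) ⟩
      (- c) * casoratian f g i ∎

    module _ {c⁻ : Carrier} (cc⁻≈1 : c * c⁻ ≈ 1#) where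

      solution-unique : ∀ {f g} → IsSolution f → IsSolution g →
                        f 0ℤ ≈ g 0ℤ → f 1ℤ ≈ g 1ℤ → ∀ i → f i ≈ g i
      solution-unique {f} {g} f-sol g-sol f0≈g0 f1≈g1 i =
        proj₁ (ℤ-induction Agree (f0≈g0 , f1≈g1) forward backward i)
        where
        Agree : ℤ → Set ℓ₂
        Agree i = f i ≈ g i × f (ℤ.suc i) ≈ g (ℤ.suc i)

        forward : ∀ i → Agree i → Agree (ℤ.suc i)
        forward i (e₀ , e₁) = e₁ , (begin
          f (ℤ.suc (ℤ.suc i))         ≈⟨ f-sol i ⟩
          k * f (ℤ.suc i) + c * f i   ≈⟨ +-cong (*-congˡ e₁) (*-congˡ e₀) ⟩
          k * g (ℤ.suc i) + c * g i   ≈⟨ g-sol i ⟨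
          g (ℤ.suc (ℤ.suc i))         ∎)

        backward : ∀ i → Agree (ℤ.suc i) → Agree i
        backward i (e₁ , e₂) = *-cancelˡ-unit cc⁻≈1 (cancelˡ _ _ _ (begin
          k * g (ℤ.suc i) + c * f i   ≈⟨ +-congʳ (*-congˡ e₁) ⟨
          k * f (ℤ.suc i) + c * f i   ≈⟨ f-sol i ⟨
          f (ℤ.suc (ℤ.suc i))         ≈⟨ e₂ ⟩
          g (ℤ.suc (ℤ.suc i))         ≈⟨ g-sol i ⟩
          k * g (ℤ.suc i) + c * g i   ∎)) , e₁

      casoratian-geometric : ∀ {f g} → IsSolution f → IsSolution g →
                             ∀ i → casoratian f g i ≈ zpow (- c) (- c⁻) i * casoratian f g 0ℤ
      casoratian-geometric {f} {g} f-sol g-sol =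
        geometric [-c][-c⁻]≈1 (casoratian f g) (casoratian-suc f-sol g-sol)
        where
        [-c][-c⁻]≈1 : (- c) * (- c⁻) ≈ 1#
        [-c][-c⁻]≈1 = trans (solve 2 (λ c c⁻ → (:- c) :* (:- c⁻) := c :* c⁻) refl c c⁻) cc⁻≈1

      addition-formula : ∀ {u f} → IsSolution u → u 0ℤ ≈ 0# → u 1ℤ ≈ 1# → IsSolution f →
                         ∀ s i → f (s ℤ.+ i) ≈ u i * f (ℤ.suc s) + u (ℤ.pred i) * (c * f s)
      addition-formula {u} {f} u-sol u0≈0 u1≈1 f-sol s =
        solution-unique (solution-shift f-sol s)
          (solution-lincomb u-sol (solution-shift u-sol ℤ.-1ℤ) (f (ℤ.suc s)) (c * f s))
          agree₀ agree₁
        where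
        c*u₋₁≈1 : c * u ℤ.-1ℤ ≈ 1#
        c*u₋₁≈1 = begin
          c * u ℤ.-1ℤ                 ≈⟨ +-identityˡ _ ⟨
          0# + c * u ℤ.-1ℤ            ≈⟨ +-congʳ (trans (*-congˡ u0≈0) (zeroʳ k)) ⟨
          k * u 0ℤ + c * u ℤ.-1ℤ      ≈⟨ u-sol ℤ.-1ℤ ⟨
          u 1ℤ                        ≈⟨ u1≈1 ⟩
          1#                          ∎

        agree₀ : f (s ℤ.+ 0ℤ) ≈ u 0ℤ * f (ℤ.suc s) + u ℤ.-1ℤ * (c * f s)
        agree₀ = begin
          f (s ℤ.+ 0ℤ)
            ≡⟨ ≡.cong f (ℤP.+-identityʳ s) ⟩
          f s
            ≈⟨ trans (*-congʳ c*u₋₁≈1) (*-identityˡ (f s)) ⟨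
          c * u ℤ.-1ℤ * f s
            ≈⟨ solve 3 (λ c u₋₁ f₀ → c :* u₋₁ :* f₀ := u₋₁ :* (c :* f₀)) refl c (u ℤ.-1ℤ) (f s) ⟩
          u ℤ.-1ℤ * (c * f s)
            ≈⟨ trans (+-congʳ (trans (*-congʳ u0≈0) (zeroˡ _))) (+-identityˡ _) ⟨
          u 0ℤ * f (ℤ.suc s) + u ℤ.-1ℤ * (c * f s) ∎

        agree₁ : f (s ℤ.+ 1ℤ) ≈ u 1ℤ * f (ℤ.suc s) + u 0ℤ * (c * f s)
        agree₁ = begin
          f (s ℤ.+ 1ℤ)
            ≡⟨ ≡.cong f (ℤP.+-comm s 1ℤ) ⟩
          f (ℤ.suc s)
            ≈⟨ trans (+-cong (*-identityˡ _) (trans (*-congʳ u0≈0) (zeroˡ _))) (+-identityʳ _) ⟨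
          1# * f (ℤ.suc s) + u 0ℤ * (c * f s)
            ≈⟨ +-congʳ (*-congʳ u1≈1) ⟨
          u 1ℤ * f (ℤ.suc s) + u 0ℤ * (c * f s) ∎

      casoratian-identity :
        ∀ {u f g} → IsSolution u → u 0ℤ ≈ 0# → u 1ℤ ≈ 1# → IsSolution f → IsSolution g →
        ∀ s i j → f (s ℤ.+ i) * g (s ℤ.+ j) - f s * g (s ℤ.+ i ℤ.+ j)
                  ≈ zpow (- c) (- c⁻) s * (f 1ℤ * g j - f 0ℤ * g (j ℤ.+ 1ℤ)) * u i
      casoratian-identity {u} {f} {g} u-sol u0≈0 u1≈1 f-sol g-sol s i j = begin
        f (s ℤ.+ i) * g (s ℤ.+ j) - f s * g (s ℤ.+ i ℤ.+ j)
          ≡⟨ ≡.cong₂ (λ t t′ → f (s ℤ.+ i) * g t - f s * g t′) (ℤP.+-comm s j) s+i+j≡j+s+i ⟩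
        f (s ℤ.+ i) * g (j ℤ.+ s) - f s * g (j ℤ.+ s ℤ.+ i)
          ≈⟨ +-cong (*-congʳ (addition-formula u-sol u0≈0 u1≈1 f-sol s i))
                    (-‿cong (*-congˡ (addition-formula u-sol u0≈0 u1≈1 g-sol (j ℤ.+ s) i))) ⟩
        (u i * f (ℤ.suc s) + u (ℤ.pred i) * (c * f s)) * g (j ℤ.+ s)
          - f s * (u i * g (ℤ.suc (j ℤ.+ s)) + u (ℤ.pred i) * (c * g (j ℤ.+ s)))
          ≈⟨ solve 7 (λ U V c f₁ f₀ g₁ g₀ →
                        (U :* f₁ :+ V :* (c :* f₀)) :* g₀ :- f₀ :* (U :* g₁ :+ V :* (c :* g₀))
                     := U :* (f₁ :* g₀ :- f₀ :* g₁))
                   refl (u i) (u (ℤ.pred i)) c (f (ℤ.suc s)) (f s) (g (ℤ.suc (j ℤ.+ s))) (g (j ℤ.+ s)) ⟩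
        u i * (f (ℤ.suc s) * g (j ℤ.+ s) - f s * g (ℤ.suc (j ℤ.+ s)))
          ≡⟨ ≡.cong (λ t → u i * (f (ℤ.suc s) * g (j ℤ.+ s) - f s * g t)) (x∙yz≈y∙xz j 1ℤ s) ⟨
        u i * casoratian f g′ s
          ≈⟨ *-congˡ (casoratian-geometric f-sol (solution-shift g-sol j) s) ⟩
        u i * (zpow (- c) (- c⁻) s * casoratian f g′ 0ℤ)
          ≡⟨ ≡.cong (λ t → u i * (zpow (- c) (- c⁻) s * (f 1ℤ * g t - f 0ℤ * g (j ℤ.+ 1ℤ))))
                    (ℤP.+-identityʳ j) ⟩
        u i * (zpow (- c) (- c⁻) s * (f 1ℤ * g j - f 0ℤ * g (j ℤ.+ 1ℤ)))
          ≈⟨ *-comm (u i) _ ⟩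
        zpow (- c) (- c⁻) s * (f 1ℤ * g j - f 0ℤ * g (j ℤ.+ 1ℤ)) * u i ∎
        where
        g′ : ℤ → Carrier
        g′ t = g (j ℤ.+ t)
        s+i+j≡j+s+i : s ℤ.+ i ℤ.+ j ≡.≡ j ℤ.+ s ℤ.+ i
        s+i+j≡j+s+i = ≡.trans (xy∙z≈xz∙y s i j) (≡.cong (ℤ._+ i) (ℤP.+-comm s j))

  module _ (a b c c⁻ x : Carrier) (cc⁻≈1 : c * c⁻ ≈ 1#) where

    fwd∘bwd : ∀ w → proj₂ (fwd a b c x (bwd a b c⁻ x w)) ≈ proj₂ w
    fwd∘bwd (y , z) = begin
      k * y + c * (- (k * c⁻) * y + c⁻ * z)
        ≈⟨ solve 5 (λ k c c⁻ y z → k :* y :+ c :* ((:- (k :* c⁻)) :* y :+ c⁻ :* z)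
                                := k :* y :+ c :* c⁻ :* (z :- k :* y))
                 refl k c c⁻ y z ⟩
      k * y + c * c⁻ * (z - k * y)  ≈⟨ +-congˡ (trans (*-congʳ cc⁻≈1) (*-identityˡ _)) ⟩
      k * y + (z - k * y)           ≈⟨ solve 2 (λ ky z → ky :+ (z :- ky) := z) refl (k * y) z ⟩
      z                             ∎
      where
      k : Carrier
      k = a * x + b

    Pseq-isSolution : ∀ p q r → IsSolution (a * x + b) c (Pseq p q r a b c c⁻ x)
    Pseq-isSolution p q r (+ n)    = refl
    Pseq-isSolution p q r -[1+ n ] = begin
      P (ℤ.suc (ℤ.suc -[1+ n ]))
        ≡⟨ P-suc-suc-neg n ⟩
      proj₂ (backward n)
        ≈⟨ fwd∘bwd (backward n) ⟨
      (a * x + b) * proj₁ (backward n) + c * P -[1+ n ]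
        ≡⟨ ≡.cong (λ t → (a * x + b) * t + c * P -[1+ n ]) (P-suc-neg n) ⟨
      (a * x + b) * P (ℤ.suc -[1+ n ]) + c * P -[1+ n ] ∎
      where
      P : ℤ → Carrier
      P = Pseq p q r a b c c⁻ x

      backward : ℕ → Carrier × Carrier
      backward n = iter (bwd a b c⁻ x) n (p , q * x + r)

      P-suc-neg : ∀ n → P (ℤ.suc -[1+ n ]) ≡.≡ proj₁ (backward n)
      P-suc-neg zero    = ≡.refl
      P-suc-neg (suc n) = ≡.refl

      P-suc-suc-neg : ∀ n → P (ℤ.suc (ℤ.suc -[1+ n ])) ≡.≡ proj₂ (backward n)
      P-suc-suc-neg zero          = ≡.refl
      P-suc-suc-neg (suc zero)    = ≡.refl
      P-suc-suc-neg (suc (suc n)) = ≡.refl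

theorem1 : ∀ {ℓ₁ ℓ₂} (R : CommutativeRing ℓ₁ ℓ₂) →
  let open CommutativeRing R
      open Seq R
  in (a b c c⁻ p₁ q₁ r₁ p₂ q₂ r₂ x : Carrier) → c * c⁻ ≈ 1# →
     ∀ (s i j : ℤ) →
     Pseq p₁ q₁ r₁ a b c c⁻ x (s ℤ.+ i) * Pseq p₂ q₂ r₂ a b c c⁻ x (s ℤ.+ j)
       - Pseq p₁ q₁ r₁ a b c c⁻ x s * Pseq p₂ q₂ r₂ a b c c⁻ x (s ℤ.+ i ℤ.+ j)
     ≈ zpow (- c) (- c⁻) s
       * (Pseq p₁ q₁ r₁ a b c c⁻ x (ℤ.+ 1) * Pseq p₂ q₂ r₂ a b c c⁻ x j
          - Pseq p₁ q₁ r₁ a b c c⁻ x (ℤ.+ 0) * Pseq p₂ q₂ r₂ a b c c⁻ x (j ℤ.+ ℤ.+ 1))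
       * Pseq 0# 0# 1# a b c c⁻ x i
theorem1 R a b c c⁻ p₁ q₁ r₁ p₂ q₂ r₂ x cc⁻≈1 =
  casoratian-identity R (a * x + b) c cc⁻≈1
    (Pseq-isSolution R a b c c⁻ x cc⁻≈1 0# 0# 1#) refl U₁≈1
    (Pseq-isSolution R a b c c⁻ x cc⁻≈1 p₁ q₁ r₁)
    (Pseq-isSolution R a b c c⁻ x cc⁻≈1 p₂ q₂ r₂)
  where
  open CommutativeRing R
  U₁≈1 : 0# * x + 1# ≈ 1#
  U₁≈1 = trans (+-congʳ (zeroˡ x)) (+-identityˡ 1#)
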